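{- There exists a plain interpretation (for the primal infon logic $\mathbf{P}$), i.e. an interpretation $I=\langle\mathcal A,v\rangle$ that is injective (for all infons $\varphi_1,\varphi_2$, $v(\varphi_1)=v(\varphi_2)$ implies $\varphi_1=\varphi_2$) and conservative (for every set $T$ of infons that is deductively closed in $\mathbf{P}$, the least closed set $M\subseteq\Sigma^*$ containing $v(T)$ contains no string $v(\psi)$ with $\psi\notin T$).
   Context: Infons: fix a set $At$ of atomic infons; infons are generated by $\varphi ::= \top \mid At \mid (\varphi\wedge\varphi)\mid(\varphi\to\varphi)$. Derivability in $\mathbf{P}$: $\Gamma\vdash\varphi$ iff there is a finite sequence $\varphi_1,\dots,\varphi_n=\varphi$ where each $\varphi_k$ is in $\Gamma\cup\{\top\}$ or follows from earlier members by one of the rules: from $\varphi_1,\varphi_2$ infer $\varphi_1\wedge\varphi_2$; from $\varphi_1\wedge\varphi_2$ infer $\varphi_i$ ($i=1,2$); from $\varphi_2$ infer $\varphi_1\to\varphi_2$; from $\varphi_1$ and $\varphi_1\to\varphi_2$ infer $\varphi_2$. A set $T$ of infons is deductively closed if $T\vdash\psi$ implies $\psi\in T$. Infon algebra: $\Sigma=\{0,1\}$; $\mathcal A=\langle\Sigma^*,\pi,l,r,\mathrm{enc},\mathrm{dec},E\rangle$ where $\pi,\mathrm{enc}:(\Sigma^*)^2\to\Sigma^*$ are total, $l,r:\Sigma^*\to\Sigma^*$ and $\mathrm{dec}:(\Sigma^*)^2\to\Sigma^*$ are partial, with $l(\pi(x,y))=x$, $r(\pi(x,y))=y$, $\mathrm{dec}(x,\mathrm{enc}(x,y))=y$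 defined and valid for all $x,y$, and $\emptyset\neq E\subseteq\Sigma^*$. A set $M\subseteq\Sigma^*$ is closed if $E\subseteq M$ and for all $a,b\in\Sigma^*$: (1) $a,b\in M\iff\pi(a,b)\in M$; (2) $a\in M$ and $\mathrm{enc}(a,b)\in M$ imply $b\in M$; (3) $b\in M$ implies $\mathrm{enc}(a,b)\in M$. (Closed sets are closed under intersection, so least closed supersets exist.) An interpretation is $I=\langle\mathcal A,v\rangle$ with $v:At\cup\{\top\}\to\Sigma^*$ total, $v(\top)\in E$, extended by $v(\varphi_1\wedge\varphi_2)=\pi(v(\varphi_1),v(\varphi_2))$, $v(\varphi_1\to\varphi_2)=\mathrm{enc}(v(\varphi_1),v(\varphi_2))$; $v(T)=\{v(\psi):\psi\in T\}$. -}

module Defs where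

open import Data.Nat using (ℕ)
open import Data.Bool using (Bool)
open import Data.List using (List)
open import Data.Maybe using (Maybe; just)
open import Data.Product using (Σ; ∃; _×_)
open import Relation.Binary.PropositionalEquality using (_≡_)
open import Relation.Nullary using (¬_)
open import Function.Definitions using (Injective)

-- Σ* with Σ = {0,1}
Str : Set
Str = List Bool

data Infon (At : Set) : Set where
  ⊤ᵢ  : Infon At
  atom : At → Infon At
  _∧ᵢ_ : Infon At → Infon At → Infon At
  _⇒ᵢ_ : Infon At → Infon At → Infon At

InfonSet : Set → Set₁
InfonSet At = Infon At → Set

-- Derivability in primal infon logic P (inductive derivations; equivalent
-- to the existence of a finite derivation sequence)
data _⊢_ {At : Set} (Γ : InfonSet At) : Infon At → Set where
  hyp   : ∀ {φ} → Γ φ → Γ ⊢ φ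
  top   : Γ ⊢ ⊤ᵢ
  ∧-i   : ∀ {φ₁ φ₂} → Γ ⊢ φ₁ → Γ ⊢ φ₂ → Γ ⊢ (φ₁ ∧ᵢ φ₂)
  ∧-e₁  : ∀ {φ₁ φ₂} → Γ ⊢ (φ₁ ∧ᵢ φ₂) → Γ ⊢ φ₁
  ∧-e₂  : ∀ {φ₁ φ₂} → Γ ⊢ (φ₁ ∧ᵢ φ₂) → Γ ⊢ φ₂
  →-i   : ∀ {φ₁ φ₂} → Γ ⊢ φ₂ → Γ ⊢ (φ₁ ⇒ᵢ φ₂)
  →-e   : ∀ {φ₁ φ₂} → Γ ⊢ φ₁ → Γ ⊢ (φ₁ ⇒ᵢ φ₂) → Γ ⊢ φ₂

DeductivelyClosed : {At : Set} → InfonSet At → Set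
DeductivelyClosed T = ∀ ψ → T ⊢ ψ → T ψ

-- Infon algebra on Σ*; partial functions are Maybe-valued
record InfonAlgebra : Set₁ where
  field
    π   : Str → Str → Str
    l   : Str → Maybe Str
    r   : Str → Maybe Str
    enc : Str → Str → Str
    dec : Str → Str → Maybe Str
    E   : Str → Set
    l-π   : ∀ x y → l (π x y) ≡ just x
    r-π   : ∀ x y → r (π x y) ≡ just y
    dec-enc : ∀ x y → dec x (enc x y) ≡ just y
    E-nonempty : ∃ λ e → E e

record Closed (𝒜 : InfonAlgebra) (M : Str → Set) : Set where
  open InfonAlgebra 𝒜
  field
    E⊆M    : ∀ x → E x → M x
    π-intro : ∀ a b → M a → M b → M (π a b)
    π-elimˡ : ∀ a b → M (π a b) → M a
    π-elimʳ : ∀ a b → M (π a b) → M b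
    enc-elim  : ∀ a b → M a → M (enc a b) → M b
    enc-intro : ∀ a b → M b → M (enc a b)

record IsLeastClosedSuperset (𝒜 : InfonAlgebra) (S M : Str → Set) : Set₁ where
  field
    closed   : Closed 𝒜 M
    contains : ∀ x → S x → M x
    least    : ∀ (N : Str → Set) → Closed 𝒜 N → (∀ x → S x → N x) → ∀ x → M x → N x

record Interpretation (At : Set) : Set₁ where
  field
    algebra : InfonAlgebra
    vAt     : At → Str
    v⊤      : Str
    v⊤∈E    : InfonAlgebra.E algebra v⊤

module _ {At : Set} (I : Interpretation At) where
  open Interpretation I
  open InfonAlgebra algebra

  val : Infon At → Str
  val ⊤ᵢ = v⊤
  val (atom a) = vAt a
  val (φ₁ ∧ᵢ φ₂) = π (val φ₁) (val φ₂)
  val (φ₁ ⇒ᵢ φ₂) = enc (val φ₁) (val φ₂)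

  image : InfonSet At → Str → Set
  image T x = Σ (Infon At) λ ψ → T ψ × val ψ ≡ x

  InjectiveInterp : Set
  InjectiveInterp = ∀ φ₁ φ₂ → val φ₁ ≡ val φ₂ → φ₁ ≡ φ₂

  Conservative : Set₁
  Conservative = ∀ (T : InfonSet At) → DeductivelyClosed T →
    ∀ (M : Str → Set) → IsLeastClosedSuperset algebra (image T) M →
    ¬ (Σ (Infon At) λ ψ → M (val ψ) × ¬ T ψ)

  Plain : Set₁
  Plain = InjectiveInterp × Conservative

module Submission where

open import Defs
open import Data.Bool using (true; false)
open import Data.List using ([]; _∷_; _++_; length; replicate; splitAt)
open import Data.List.Properties using (length-replicate; ∷-injectiveʳ)
open import Data.Maybe using (Maybe; just; nothing)
import Data.Maybe as Maybe
open import Data.Maybe.Properties using (just-injective)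
open import Data.Nat using (ℕ; zero; suc)
open import Data.Product using (Σ; _,_; _×_; proj₁; proj₂; map₁; uncurry)
open import Data.Product.Properties using (,-injectiveˡ; ,-injectiveʳ)
open import Function.Definitions using (Injective)
open import Relation.Binary.PropositionalEquality
  using (_≡_; refl; sym; trans; cong; cong₂; subst; module ≡-Reasoning)

-- v serialises the syntax tree of an infon: πₛ and encₛ tag a self-delimiting
-- pair (the length of its left component is written first, in unary), so v is
-- injective. The least closed set containing v(T) lies inside the set generated
-- from v(T) by the two introduction rules alone; eliminating on that set only
-- retraces ∧-elimination and modus ponens of P, so by deductive closure it meets
-- the range of v exactly in v(T).

unary : ℕ → Str
unary n = replicate n true

unary-injective : ∀ {m n} → unary m ≡ unary n → m ≡ n
unary-injective {m} {n} eq =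
  trans (sym (length-replicate m)) (trans (cong length eq) (length-replicate n))

pair : Str → Str → Str
pair x y = unary (length x) ++ false ∷ x ++ y

unary-prefix : Str → Maybe (ℕ × Str)
unary-prefix []          = nothing
unary-prefix (false ∷ s) = just (0 , s)
unary-prefix (true ∷ s)  = Maybe.map (map₁ suc) (unary-prefix s)

unpair : Str → Maybe (Str × Str)
unpair s = Maybe.map (uncurry splitAt) (unary-prefix s)

unary-prefix-unary : ∀ n s → unary-prefix (unary n ++ false ∷ s) ≡ just (n , s)
unary-prefix-unary zero    s = refl
unary-prefix-unary (suc n) s = cong (Maybe.map (map₁ suc)) (unary-prefix-unary n s)

splitAt-length-++ : ∀ (x y : Str) → splitAt (length x) (x ++ y) ≡ (x , y)
splitAt-length-++ []      y = refl
splitAt-length-++ (b ∷ x) y = cong (map₁ (b ∷_)) (splitAt-length-++ x y)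

unpair-pair : ∀ x y → unpair (pair x y) ≡ just (x , y)
unpair-pair x y = begin
  unpair (pair x y)
    ≡⟨ cong (Maybe.map (uncurry splitAt)) (unary-prefix-unary (length x) (x ++ y)) ⟩
  just (splitAt (length x) (x ++ y))
    ≡⟨ cong just (splitAt-length-++ x y) ⟩
  just (x , y)
    ∎
  where open ≡-Reasoning

pair-injective : ∀ {x y x′ y′} → pair x y ≡ pair x′ y′ → x ≡ x′ × y ≡ y′
pair-injective {x} {y} {x′} {y′} eq = ,-injectiveˡ xy≡x′y′ , ,-injectiveʳ xy≡x′y′
  where
  xy≡x′y′ : (x , y) ≡ (x′ , y′)
  xy≡x′y′ = just-injective
    (trans (sym (unpair-pair x y)) (trans (cong unpair eq) (unpair-pair x′ y′)))

πₛ : Str → Str → Str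
πₛ x y = true ∷ true ∷ pair x y

encₛ : Str → Str → Str
encₛ x y = true ∷ false ∷ pair x y

πₛ-injective : ∀ {x y x′ y′} → πₛ x y ≡ πₛ x′ y′ → x ≡ x′ × y ≡ y′
πₛ-injective eq = pair-injective (∷-injectiveʳ (∷-injectiveʳ eq))

encₛ-injective : ∀ {x y x′ y′} → encₛ x y ≡ encₛ x′ y′ → x ≡ x′ × y ≡ y′
encₛ-injective eq = pair-injective (∷-injectiveʳ (∷-injectiveʳ eq))

leftₛ : Str → Maybe Str
leftₛ (_ ∷ _ ∷ s) = Maybe.map proj₁ (unpair s)
leftₛ _           = nothing

rightₛ : Str → Maybe Str
rightₛ (_ ∷ _ ∷ s) = Maybe.map proj₂ (unpair s)
rightₛ _           = nothing

stringAlgebra : InfonAlgebra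
stringAlgebra = record
  { π          = πₛ
  ; l          = leftₛ
  ; r          = rightₛ
  ; enc        = encₛ
  ; dec        = λ _ → rightₛ
  ; E          = _≡ []
  ; l-π        = λ x y → cong (Maybe.map proj₁) (unpair-pair x y)
  ; r-π        = λ x y → cong (Maybe.map proj₂) (unpair-pair x y)
  ; dec-enc    = λ x y → cong (Maybe.map proj₂) (unpair-pair x y)
  ; E-nonempty = [] , refl
  }

module _ (At : Set) (code : At → ℕ) (code-injective : Injective _≡_ _≡_ code) where

  interpretation : Interpretation At
  interpretation = record
    { algebra = stringAlgebra
    ; vAt     = λ a → false ∷ unary (code a)
    ; v⊤      = []
    ; v⊤∈E    = refl
    }

  v : Infon At → Str
  v = val interpretation

  data ∧-Preimage (a b : Str) : Infon At → Set where
    ∧-preimage : ∀ {ψ₁ ψ₂} → v ψ₁ ≡ a → v ψ₂ ≡ b → ∧-Preimage a b (ψ₁ ∧ᵢ ψ₂)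

  data ⇒-Preimage (a b : Str) : Infon At → Set where
    ⇒-preimage : ∀ {ψ₁ ψ₂} → v ψ₁ ≡ a → v ψ₂ ≡ b → ⇒-Preimage a b (ψ₁ ⇒ᵢ ψ₂)

  ∧-preimage-of : ∀ a b ψ → v ψ ≡ πₛ a b → ∧-Preimage a b ψ
  ∧-preimage-of _ _ ⊤ᵢ         ()
  ∧-preimage-of _ _ (atom _)   ()
  ∧-preimage-of _ _ (_ ⇒ᵢ _)   ()
  ∧-preimage-of _ _ (_ ∧ᵢ _) eq = uncurry ∧-preimage (πₛ-injective eq)

  ⇒-preimage-of : ∀ a b ψ → v ψ ≡ encₛ a b → ⇒-Preimage a b ψ
  ⇒-preimage-of _ _ ⊤ᵢ         ()
  ⇒-preimage-of _ _ (atom _)   ()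
  ⇒-preimage-of _ _ (_ ∧ᵢ _)   ()
  ⇒-preimage-of _ _ (_ ⇒ᵢ _) eq = uncurry ⇒-preimage (encₛ-injective eq)

  val-injective : InjectiveInterp interpretation
  val-injective ⊤ᵢ       ⊤ᵢ       _  = refl
  val-injective ⊤ᵢ       (atom _) ()
  val-injective ⊤ᵢ       (_ ∧ᵢ _) ()
  val-injective ⊤ᵢ       (_ ⇒ᵢ _) ()
  val-injective (atom _) ⊤ᵢ       ()
  val-injective (atom _) (atom _) eq =
    cong atom (code-injective (unary-injective (∷-injectiveʳ eq)))
  val-injective (atom _) (_ ∧ᵢ _) ()
  val-injective (atom _) (_ ⇒ᵢ _) ()
  val-injective (φ₁ ∧ᵢ φ₂) ψ eq with ∧-preimage-of (v φ₁) (v φ₂) ψ (sym eq)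
  ... | ∧-preimage e₁ e₂ =
    cong₂ _∧ᵢ_ (val-injective φ₁ _ (sym e₁)) (val-injective φ₂ _ (sym e₂))
  val-injective (φ₁ ⇒ᵢ φ₂) ψ eq with ⇒-preimage-of (v φ₁) (v φ₂) ψ (sym eq)
  ... | ⇒-preimage e₁ e₂ =
    cong₂ _⇒ᵢ_ (val-injective φ₁ _ (sym e₁)) (val-injective φ₂ _ (sym e₂))

  module _ (T : InfonSet At) (T-closed : DeductivelyClosed T) where

    data Generated : Str → Set where
      base      : ∀ ψ → T ψ → Generated (v ψ)
      π-intro   : ∀ {a b} → Generated a → Generated b → Generated (πₛ a b)
      enc-intro : ∀ {a b} → Generated b → Generated (encₛ a b)

    generated-sound : ∀ {x} → Generated x → ∀ ψ → v ψ ≡ x → T ψ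
    generated-sound (base φ t) ψ eq = subst T (val-injective φ ψ (sym eq)) t
    generated-sound (π-intro {a} {b} ga gb) ψ eq with ∧-preimage-of a b ψ eq
    ... | ∧-preimage e₁ e₂ =
      T-closed _ (∧-i (hyp (generated-sound ga _ e₁)) (hyp (generated-sound gb _ e₂)))
    generated-sound (enc-intro {a} {b} gb) ψ eq with ⇒-preimage-of a b ψ eq
    ... | ⇒-preimage _ e₂ = T-closed _ (→-i (hyp (generated-sound gb _ e₂)))

    -- The index is abstracted into an equation: πₛ and encₛ are not constructors,
    -- so Generated (πₛ a b) cannot be split on directly.
    generated-π-elim : ∀ {x a b} → Generated x → x ≡ πₛ a b → Generated a × Generated b
    generated-π-elim {a = a} {b} (base ψ t) eq with ∧-preimage-of a b ψ eq
    ... | ∧-preimage refl refl =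
      base _ (T-closed _ (∧-e₁ (hyp t))) , base _ (T-closed _ (∧-e₂ (hyp t)))
    generated-π-elim {a = a} {b} (π-intro {a′} {b′} ga gb) eq
      with πₛ-injective {a′} {b′} {a} {b} eq
    ... | refl , refl = ga , gb
    generated-π-elim (enc-intro _) ()

    generated-enc-elim : ∀ {x a b} → Generated a → Generated x → x ≡ encₛ a b → Generated b
    generated-enc-elim {a = a} {b} ga (base ψ t) eq with ⇒-preimage-of a b ψ eq
    ... | ⇒-preimage e₁ refl =
      base _ (T-closed _ (→-e (hyp (generated-sound ga _ e₁)) (hyp t)))
    generated-enc-elim {a = a} {b} _ (enc-intro {a′} {b′} gb) eq
      with encₛ-injective {a′} {b′} {a} {b} eq
    ... | refl , refl = gb
    generated-enc-elim _ (π-intro _ _) ()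

    generated-closed : Closed stringAlgebra Generated
    generated-closed = record
      { E⊆M       = λ { _ refl → base ⊤ᵢ (T-closed _ top) }
      ; π-intro   = λ _ _ → π-intro
      ; π-elimˡ   = λ _ _ g → proj₁ (generated-π-elim g refl)
      ; π-elimʳ   = λ _ _ g → proj₂ (generated-π-elim g refl)
      ; enc-elim  = λ _ _ ga g → generated-enc-elim ga g refl
      ; enc-intro = λ _ _ → enc-intro
      }

  conservative : Conservative interpretation
  conservative T T-closed M M-least (ψ , vψ∈M , ψ∉T) =
    ψ∉T (generated-sound T T-closed (M⊆generated (v ψ) vψ∈M) ψ refl)
    where
    image⊆generated : ∀ x → image interpretation T x → Generated T T-closed x
    image⊆generated _ (φ , t , refl) = base φ t

    M⊆generated : ∀ x → M x → Generated T T-closed x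
    M⊆generated = IsLeastClosedSuperset.least M-least
      (Generated T T-closed) (generated-closed T T-closed) image⊆generated

lemma2 : (At : Set) → (code : At → ℕ) → Injective _≡_ _≡_ code →
    Σ (Interpretation At) λ I → Plain I
lemma2 At code code-injective =
  interpretation At code code-injective ,
  val-injective At code code-injective ,
  conservative At code code-injective
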